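{- Let $m\ge 2$ and let $\Phi_1,\dots,\Phi_{m-1}$ be the functions defined by an $m$-binarization tree. Let $n_0,\dots,n_{m-1}$ be nonnegative integers with sum $n$ and let $S=S_{(n_0,n_1,\dots,n_{m-1})}$. Then the mapping $x\mapsto(\Phi_1(x),\dots,\Phi_{m-1}(x))$ is a one-to-one correspondence between $S$ and $\Phi_1(S)\times\cdots\times\Phi_{m-1}(S)$, where $\Phi_i(S)=\{\Phi_i(x)\mid x\in S\}$.
   Context: An $m$-binarization tree is a binary tree in which every internal node has two children, with $m$ leaves labeled bijectively by $0,1,\dots,m-1$ and $m-1$ internal nodes named $1,\dots,m-1$ (node $1$ the root). For internal node $v$, $\Phi_v\colon\{0,\dots,m-1\}\to\{0,1,\lambda\}$ is given by $\Phi_v(x)=0$ if leaf $x$ is in the left subtree of $v$, $1$ if in the right subtree of $v$, and $\lambda$ (empty string) otherwise; it is extended to strings by $\Phi_v(x_1\dots x_n)=\Phi_v(x_1)*\cdots*\Phi_v(x_n)$ with $*$ concatenation. $S_{(n_0,\dots,n_{m-1})}$ is the set of strings over $\{0,\dots,m-1\}$ of length $n_0+\cdots+n_{m-1}$ with exactly $n_j$ occurrences of $j$ for each $j$. -}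

module Defs where

open import Data.Nat using (ℕ; zero; suc; _≤_)
open import Data.Fin using (Fin)
open import Data.Fin.Properties using (_≟_)
open import Data.Bool using (Bool; true; false)
open import Data.Maybe using (Maybe; just; nothing)
open import Data.List using (List; []; _∷_; _++_; length; filter; mapMaybe)
open import Relation.Nullary using (yes; no)
open import Relation.Binary.PropositionalEquality using (_≡_)

data Tree (A : Set) : Set where
  leaf : A → Tree A
  node : Tree A → Tree A → Tree A

leaves : {A : Set} → Tree A → List A
leaves (leaf a)   = [ a ]
  where open Data.List using ([_])
leaves (node l r) = leaves l ++ leaves r

-- Internal nodes of a tree, as positions (paths from the root).
data Pos {A : Set} : Tree A → Set where
  here : {l r : Tree A} → Pos (node l r)
  inl  : {l r : Tree A} → Pos l → Pos (node l r)
  inr  : {l r : Tree A} → Pos r → Pos (node l r)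

memb : {m : ℕ} → Fin m → List (Fin m) → Bool
memb x [] = false
memb x (y ∷ ys) with x ≟ y
... | yes _ = true
... | no  _ = memb x ys

-- Φ_v on a single symbol: just false = 0 (left subtree), just true = 1
-- (right subtree), nothing = λ (empty string).
Φ₁ : {m : ℕ} (t : Tree (Fin m)) → Pos t → Fin m → Maybe Bool
Φ₁ (node l r) here x with memb x (leaves l) | memb x (leaves r)
... | true  | _     = just false
... | false | true  = just true
... | false | false = nothing
Φ₁ (node l r) (inl p) x = Φ₁ l p x
Φ₁ (node l r) (inr p) x = Φ₁ r p x

Φ : {m : ℕ} (t : Tree (Fin m)) → Pos t → List (Fin m) → List Bool
Φ t v = mapMaybe (Φ₁ t v)

count : {m : ℕ} → Fin m → List (Fin m) → ℕ
count j x = length (filter (_≟ j) x)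

-- membership in S_(n_0,...,n_{m-1}): exactly n_j occurrences of each j
-- (length is then automatically n_0 + ... + n_{m-1}).
InS : {m : ℕ} → (Fin m → ℕ) → List (Fin m) → Set
InS ns x = ∀ j → count j x ≡ ns j

module Submission where

-- The proof is an induction over the tree, run for any tree with distinct
-- leaf labels and for the local sets Word t of words over the leaves of t
-- with the prescribed letter counts.  A word z over node l r is the
-- interleaving, along its root projection Φ_root(z) ∈ {0,1}*, of its
-- restrictions z|l and z|r (split), and Φ at a node inside l (resp. r)
-- only sees z|l (resp. z|r) (Φ-restrict).  For surjectivity, words of l and r realising the components
-- below l and r are interleaved along the root component; this reproduces
-- the root component, because the root pattern of an interleaving depends
-- only on the lengths of its two parts and all words of a subtree have the
-- same length (root-pattern).

open import Defs
open import Data.Nat using (ℕ; suc; _≤_; _∸_; _+_)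
open import Data.Nat.Properties using (+-suc)
open import Data.Fin using (Fin; toℕ)
open import Data.Vec using (Vec; tabulate; lookup)
open import Data.Vec.Properties using (lookup∘tabulate; tabulate∘lookup; tabulate-cong)
open import Data.Fin.Properties using (_≟_)
open import Data.Bool using (Bool; true; false; _∨_)
open import Data.Bool.Properties using (∨-zeroʳ; ∨-conicalˡ; ∨-conicalʳ; T-≡)
open import Data.Unit using (⊤; tt)
open import Data.Maybe using (Maybe; just; nothing; maybe′)
open import Function using (id; _∘_)
open import Function.Bundles using (Equivalence; _↔_; Inverse)
open import Data.List using (List; []; _∷_; _++_; length; filterᵇ; mapMaybe; replicate; allFin)
open import Data.List.Properties using (filter-all; filter-reject; length-replicate; length-++; mapMaybe-++; filter-++; ++-identityʳ)
open import Data.List.Relation.Unary.All using (All; []; _∷_)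
import Data.List.Relation.Unary.All as All
import Data.List.Relation.Unary.All.Properties as AllP
open import Data.List.Relation.Unary.Any using (here; there)
open import Data.List.Membership.Propositional using (_∈_)
open import Data.List.Relation.Unary.Unique.Propositional using (Unique)
open import Data.List.Relation.Unary.Unique.Propositional.Properties using (allFin⁺)
open import Data.List.Relation.Binary.Permutation.Propositional using (_↭_; ↭-sym; ↭⇒↭ₛ)
open import Data.List.Relation.Binary.Permutation.Propositional.Properties using (∈-resp-↭)
import Data.List.Relation.Binary.Permutation.Setoid.Properties as PermutationSetoid
open import Data.List.Membership.Propositional.Properties using (∈-allFin)
open import Data.List.Relation.Unary.AllPairs using ([]; _∷_)
open import Data.Product using (Σ; _×_; _,_; proj₁)
open import Relation.Nullary using (yes; no; does; ¬_; contradiction; T?)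
open import Relation.Binary.PropositionalEquality

interleave : {A : Set} → List Bool → List A → List A → List A
interleave []          a       b       = a ++ b
interleave (false ∷ s) []      b       = interleave s [] b
interleave (false ∷ s) (x ∷ a) b       = x ∷ interleave s a b
interleave (true ∷ s)  a       []      = interleave s a []
interleave (true ∷ s)  a       (y ∷ b) = y ∷ interleave s a b

module _ {A : Set} where

  interleave-All : {P : A → Set} (s : List Bool) {a b : List A} →
                   All P a → All P b → All P (interleave s a b)
  interleave-All []          pa       pb       = AllP.++⁺ pa pb
  interleave-All (false ∷ s) []       pb       = interleave-All s [] pb
  interleave-All (false ∷ s) (p ∷ pa) pb       = p ∷ interleave-All s pa pb
  interleave-All (true ∷ s)  pa       []       = interleave-All s pa []
  interleave-All (true ∷ s)  pa       (p ∷ pb) = p ∷ interleave-All s pa pb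

  length-interleave : (s : List Bool) (a b : List A) →
                      length (interleave s a b) ≡ length a + length b
  length-interleave []          a       b       = length-++ a
  length-interleave (false ∷ s) []      b       = length-interleave s [] b
  length-interleave (false ∷ s) (x ∷ a) b       = cong suc (length-interleave s a b)
  length-interleave (true ∷ s)  a       []      = length-interleave s a []
  length-interleave (true ∷ s)  a       (y ∷ b) =
    trans (cong suc (length-interleave s a b)) (sym (+-suc (length a) (length b)))

  filterᵇ-accept : {f : A → Bool} {a : List A} → All (λ x → f x ≡ true) a → filterᵇ f a ≡ a
  filterᵇ-accept []            = refl
  filterᵇ-accept (e ∷ pa) rewrite e = cong (_ ∷_) (filterᵇ-accept pa)

  filterᵇ-reject : {f : A → Bool} {b : List A} → All (λ x → f x ≡ false) b → filterᵇ f b ≡ []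
  filterᵇ-reject []            = refl
  filterᵇ-reject (e ∷ pb) rewrite e = filterᵇ-reject pb

  filterᵇ-interleaveˡ : {f : A → Bool} (s : List Bool) {a b : List A} →
                        All (λ x → f x ≡ true) a → All (λ x → f x ≡ false) b →
                        filterᵇ f (interleave s a b) ≡ a
  filterᵇ-interleaveˡ {f} [] {a} {b} pa pb = begin
    filterᵇ f (a ++ b)             ≡⟨ filter-++ _ a b ⟩
    filterᵇ f a ++ filterᵇ f b     ≡⟨ cong₂ _++_ (filterᵇ-accept pa) (filterᵇ-reject pb) ⟩
    a ++ []                        ≡⟨ ++-identityʳ a ⟩
    a                              ∎
    where open ≡-Reasoning
  filterᵇ-interleaveˡ (false ∷ s) []       pb       = filterᵇ-interleaveˡ s [] pb
  filterᵇ-interleaveˡ (false ∷ s) (e ∷ pa) pb       rewrite e = cong (_ ∷_) (filterᵇ-interleaveˡ s pa pb)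
  filterᵇ-interleaveˡ (true ∷ s)  pa       []       = filterᵇ-interleaveˡ s pa []
  filterᵇ-interleaveˡ (true ∷ s)  pa       (e ∷ pb) rewrite e = filterᵇ-interleaveˡ s pa pb

  filterᵇ-interleaveʳ : {f : A → Bool} (s : List Bool) {a b : List A} →
                        All (λ x → f x ≡ false) a → All (λ x → f x ≡ true) b →
                        filterᵇ f (interleave s a b) ≡ b
  filterᵇ-interleaveʳ {f} [] {a} {b} pa pb = begin
    filterᵇ f (a ++ b)             ≡⟨ filter-++ _ a b ⟩
    filterᵇ f a ++ filterᵇ f b     ≡⟨ cong₂ _++_ (filterᵇ-reject pa) (filterᵇ-accept pb) ⟩
    b                              ∎
    where open ≡-Reasoning
  filterᵇ-interleaveʳ (false ∷ s) []       pb       = filterᵇ-interleaveʳ s [] pb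
  filterᵇ-interleaveʳ (false ∷ s) (e ∷ pa) pb       rewrite e = filterᵇ-interleaveʳ s pa pb
  filterᵇ-interleaveʳ (true ∷ s)  pa       []       = filterᵇ-interleaveʳ s pa []
  filterᵇ-interleaveʳ (true ∷ s)  pa       (e ∷ pb) rewrite e = cong (_ ∷_) (filterᵇ-interleaveʳ s pa pb)

  mapMaybe-const : {B : Set} {h : A → Maybe B} {c : B} {a : List A} →
                   All (λ x → h x ≡ just c) a → mapMaybe h a ≡ replicate (length a) c
  mapMaybe-const []            = refl
  mapMaybe-const (e ∷ pa) rewrite e = cong (_ ∷_) (mapMaybe-const pa)

  mapMaybe-interleave : {h : A → Maybe Bool} (s : List Bool) {a b : List A} →
                        All (λ x → h x ≡ just false) a → All (λ x → h x ≡ just true) b →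
                        mapMaybe h (interleave s a b)
                          ≡ interleave s (replicate (length a) false) (replicate (length b) true)
  mapMaybe-interleave {h} [] {a} {b} pa pb = begin
    mapMaybe h (a ++ b)              ≡⟨ mapMaybe-++ h a b ⟩
    mapMaybe h a ++ mapMaybe h b     ≡⟨ cong₂ _++_ (mapMaybe-const pa) (mapMaybe-const pb) ⟩
    replicate (length a) false ++ replicate (length b) true ∎
    where open ≡-Reasoning
  mapMaybe-interleave (false ∷ s) []       pb       = mapMaybe-interleave s [] pb
  mapMaybe-interleave (false ∷ s) (e ∷ pa) pb       rewrite e = cong (false ∷_) (mapMaybe-interleave s pa pb)
  mapMaybe-interleave (true ∷ s)  pa       []       = mapMaybe-interleave s pa []
  mapMaybe-interleave (true ∷ s)  pa       (e ∷ pb) rewrite e = cong (true ∷_) (mapMaybe-interleave s pa pb)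

  mapMaybe-filterᵇ : {B : Set} {g : A → Maybe B} {f : A → Bool} →
                     (∀ x → f x ≡ false → g x ≡ nothing) →
                     (z : List A) → mapMaybe g (filterᵇ f z) ≡ mapMaybe g z
  mapMaybe-filterᵇ         g-out []      = refl
  mapMaybe-filterᵇ {g = g} {f} g-out (x ∷ z) with f x in e
  ... | true  = cong (maybe′ _∷_ id (g x)) (mapMaybe-filterᵇ g-out z)
  ... | false rewrite g-out x e = mapMaybe-filterᵇ g-out z

module _ {m : ℕ} where

  count-∷-≢ : {x j : Fin m} (z : List (Fin m)) → ¬ x ≡ j → count j (x ∷ z) ≡ count j z
  count-∷-≢ z x≢j = cong length (filter-reject (_≟ _) x≢j)

  count-∷-cong : {x j : Fin m} {z₁ z₂ : List (Fin m)} →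
                 count j z₁ ≡ count j z₂ → count j (x ∷ z₁) ≡ count j (x ∷ z₂)
  count-∷-cong {x} {j} e with does (x ≟ j)
  ... | true  = cong suc e
  ... | false = e

  count-filterᵇ : {f : Fin m → Bool} {j : Fin m} → f j ≡ true →
                  (z : List (Fin m)) → count j (filterᵇ f z) ≡ count j z
  count-filterᵇ     fj []      = refl
  count-filterᵇ {f} {j} fj (x ∷ z) with f x in fx
  ... | true  = count-∷-cong {x} {j} {filterᵇ f z} {z} (count-filterᵇ fj z)
  ... | false = trans (count-filterᵇ fj z) (sym (count-∷-≢ z x≢j))
    where x≢j : ¬ x ≡ j
          x≢j refl = contradiction (trans (sym fx) fj) (λ ())

  count-replicate : (a : Fin m) (k : ℕ) → count a (replicate k a) ≡ k
  count-replicate a k =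
    trans (cong length (filter-all (_≟ a) (AllP.replicate⁺ k refl))) (length-replicate k)

  memb-++ : (x : Fin m) (xs ys : List (Fin m)) → memb x (xs ++ ys) ≡ memb x xs ∨ memb x ys
  memb-++ x []       ys = refl
  memb-++ x (y ∷ xs) ys with x ≟ y
  ... | yes _ = refl
  ... | no  _ = memb-++ x xs ys

  memb⇒∈ : {x : Fin m} (xs : List (Fin m)) → memb x xs ≡ true → x ∈ xs
  memb⇒∈ {x} (y ∷ ys) e with x ≟ y
  ... | yes x≡y = here x≡y
  ... | no  _   = there (memb⇒∈ ys e)

  ∈⇒memb : {x : Fin m} {xs : List (Fin m)} → x ∈ xs → memb x xs ≡ true
  ∈⇒memb {x} {y ∷ ys} x∈ with x ≟ y | x∈
  ... | yes _   | _          = refl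
  ... | no  x≢y | here x≡y   = contradiction x≡y x≢y
  ... | no  _   | there x∈ys = ∈⇒memb x∈ys

  inT : Tree (Fin m) → Fin m → Bool
  inT t a = memb a (leaves t)

  inT-node : (l r : Tree (Fin m)) (a : Fin m) → inT (node l r) a ≡ inT l a ∨ inT r a
  inT-node l r a = memb-++ a (leaves l) (leaves r)

  inT-nodeˡ : (l r : Tree (Fin m)) {a : Fin m} → inT l a ≡ true → inT (node l r) a ≡ true
  inT-nodeˡ l r {a} e = trans (inT-node l r a) (cong (_∨ inT r a) e)

  inT-nodeʳ : (l r : Tree (Fin m)) {a : Fin m} → inT r a ≡ true → inT (node l r) a ≡ true
  inT-nodeʳ l r {a} e = trans (inT-node l r a) (trans (cong (inT l a ∨_) e) (∨-zeroʳ (inT l a)))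

  outside-nodeˡ : (l r : Tree (Fin m)) {a : Fin m} → inT (node l r) a ≡ false → inT l a ≡ false
  outside-nodeˡ l r {a} e = ∨-conicalˡ (inT l a) (inT r a) (trans (sym (inT-node l r a)) e)

  outside-nodeʳ : (l r : Tree (Fin m)) {a : Fin m} → inT (node l r) a ≡ false → inT r a ≡ false
  outside-nodeʳ l r {a} e = ∨-conicalʳ (inT l a) (inT r a) (trans (sym (inT-node l r a)) e)

  inside-nodeʳ : (l r : Tree (Fin m)) {a : Fin m} →
                 inT (node l r) a ≡ true → inT l a ≡ false → inT r a ≡ true
  inside-nodeʳ l r {a} e f = trans (cong (_∨ inT r a) (sym f)) (trans (sym (inT-node l r a)) e)

  Over : Tree (Fin m) → List (Fin m) → Set
  Over t = All (λ a → inT t a ≡ true)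

  restrict : Tree (Fin m) → List (Fin m) → List (Fin m)
  restrict t = filterᵇ (inT t)

  restrict-Over : (t : Tree (Fin m)) (z : List (Fin m)) → Over t (restrict t z)
  restrict-Over t z = All.map (Equivalence.to T-≡) (AllP.all-filter (T? ∘ inT t) z)

  Distinct : Tree (Fin m) → Set
  Distinct (leaf a)   = ⊤
  Distinct (node l r) = (∀ a → inT l a ≡ true → inT r a ≡ false) × Distinct l × Distinct r

  disjointʳ : (l r : Tree (Fin m)) → Distinct (node l r) → ∀ a → inT r a ≡ true → inT l a ≡ false
  disjointʳ l r (disj , _) a e with inT l a in f
  ... | true  = contradiction (trans (sym e) (disj a f)) (λ ())
  ... | false = refl

  Φ₁-outside : (t : Tree (Fin m)) (p : Pos t) (a : Fin m) → inT t a ≡ false → Φ₁ t p a ≡ nothing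
  Φ₁-outside (node l r) here    a e rewrite outside-nodeˡ l r e | outside-nodeʳ l r e = refl
  Φ₁-outside (node l r) (inl p) a e = Φ₁-outside l p a (outside-nodeˡ l r e)
  Φ₁-outside (node l r) (inr p) a e = Φ₁-outside r p a (outside-nodeʳ l r e)

  Φ₁-left : (l r : Tree (Fin m)) {a : Fin m} → inT l a ≡ true → Φ₁ (node l r) here a ≡ just false
  Φ₁-left l r e rewrite e = refl

  Φ₁-right : (l r : Tree (Fin m)) → Distinct (node l r) →
             {a : Fin m} → inT r a ≡ true → Φ₁ (node l r) here a ≡ just true
  Φ₁-right l r d {a} e rewrite disjointʳ l r d a e | e = refl

  Φ-restrict : (t : Tree (Fin m)) (p : Pos t) (z : List (Fin m)) → Φ t p (restrict t z) ≡ Φ t p z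
  Φ-restrict t p = mapMaybe-filterᵇ (Φ₁-outside t p)

  inT-leaf : (a : Fin m) → inT (leaf a) a ≡ true
  inT-leaf a = ∈⇒memb {a} {a ∷ []} (here refl)

  leaf-label : (a : Fin m) {j : Fin m} → inT (leaf a) j ≡ true → j ≡ a
  leaf-label a {j} e with memb⇒∈ {j} (a ∷ []) e
  ... | here j≡a = j≡a

  Over-leaf : (a : Fin m) {z : List (Fin m)} → Over (leaf a) z → z ≡ replicate (length z) a
  Over-leaf a []       = refl
  Over-leaf a (e ∷ pz) = cong₂ _∷_ (leaf-label a e) (Over-leaf a pz)

  split : (l r : Tree (Fin m)) → Distinct (node l r) → {z : List (Fin m)} → Over (node l r) z →
          interleave (Φ (node l r) here z) (restrict l z) (restrict r z) ≡ z
  split l r d           []       = refl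
  split l r d@(disj , _) {a ∷ z} (e ∷ pz) with inT l a in f
  ... | true  rewrite disj a f = cong (a ∷_) (split l r d pz)
  ... | false rewrite inside-nodeʳ l r e f = cong (a ∷_) (split l r d pz)

  module _ (ns : Fin m → ℕ) where

    -- Word t z : z is a word over the leaves of t containing each leaf
    -- label j exactly ns j times (S_(n_0,…,n_{m-1}) localised to t).
    Word : Tree (Fin m) → List (Fin m) → Set
    Word t z = Over t z × (∀ j → inT t j ≡ true → count j z ≡ ns j)

    word-leaf : (a : Fin m) {z : List (Fin m)} → Word (leaf a) z → z ≡ replicate (ns a) a
    word-leaf a {z} (over , counts) = begin
      z                                   ≡⟨ Over-leaf a over ⟩
      replicate (length z) a              ≡⟨ cong (λ k → replicate k a) length≡ns ⟩
      replicate (ns a) a                  ∎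
      where
      open ≡-Reasoning
      length≡ns : length z ≡ ns a
      length≡ns = begin
        length z                          ≡⟨ sym (count-replicate a (length z)) ⟩
        count a (replicate (length z) a)  ≡⟨ cong (count a) (sym (Over-leaf a over)) ⟩
        count a z                         ≡⟨ counts a (inT-leaf a) ⟩
        ns a                              ∎

    replicate-word : (a : Fin m) → Word (leaf a) (replicate (ns a) a)
    replicate-word a = AllP.replicate⁺ (ns a) (inT-leaf a) , counts
      where
      counts : ∀ j → inT (leaf a) j ≡ true → count j (replicate (ns a) a) ≡ ns j
      counts j e = subst (λ k → count k (replicate (ns a) a) ≡ ns k) (sym (leaf-label a e))
                         (count-replicate a (ns a))

    restrict-word : (s t : Tree (Fin m)) → (∀ {j} → inT s j ≡ true → inT t j ≡ true) →
                    {z : List (Fin m)} → Word t z → Word s (restrict s z)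
    restrict-word s t s⊆t {z} (_ , counts) =
      restrict-Over s z , λ j e → trans (count-filterᵇ e z) (counts j (s⊆t e))

    restrictˡ-word : (l r : Tree (Fin m)) {z : List (Fin m)} → Word (node l r) z → Word l (restrict l z)
    restrictˡ-word l r = restrict-word l (node l r) (inT-nodeˡ l r)

    restrictʳ-word : (l r : Tree (Fin m)) {z : List (Fin m)} → Word (node l r) z → Word r (restrict r z)
    restrictʳ-word l r = restrict-word r (node l r) (inT-nodeʳ l r)

    node-word : (l r : Tree (Fin m)) {z : List (Fin m)} → Over (node l r) z →
                Word l (restrict l z) → Word r (restrict r z) → Word (node l r) z
    node-word l r {z} over (_ , countsˡ) (_ , countsʳ) = over , counts
      where
      counts : ∀ j → inT (node l r) j ≡ true → count j z ≡ ns j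
      counts j e with inT l j in f
      ... | true  = trans (sym (count-filterᵇ f z)) (countsˡ j f)
      ... | false = trans (sym (count-filterᵇ g z)) (countsʳ j g)
        where g = inside-nodeʳ l r e f

    word-length : (t : Tree (Fin m)) → Distinct t → {x y : List (Fin m)} →
                  Word t x → Word t y → length x ≡ length y
    word-length (leaf a)   _                  wx wy = cong length (trans (word-leaf a wx) (sym (word-leaf a wy)))
    word-length (node l r) d@(_ , dl , dr) {x} {y} wx wy = begin
      length x                                        ≡⟨ length-split wx ⟩
      length (restrict l x) + length (restrict r x)   ≡⟨ cong₂ _+_ (word-length l dl (restrictˡ-word l r wx) (restrictˡ-word l r wy))
                                                                   (word-length r dr (restrictʳ-word l r wx) (restrictʳ-word l r wy)) ⟩
      length (restrict l y) + length (restrict r y)   ≡⟨ sym (length-split wy) ⟩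
      length y                                        ∎
      where
      open ≡-Reasoning
      length-split : {z : List (Fin m)} → Word (node l r) z →
                     length z ≡ length (restrict l z) + length (restrict r z)
      length-split {z} (over , _) =
        trans (cong length (sym (split l r d over)))
              (length-interleave (Φ (node l r) here z) (restrict l z) (restrict r z))

    -- Injectivity: a word of t is determined by its projections Φ t p.
    -- At a node, the root projection and the words of the subtrees (which
    -- are determined inductively) reassemble the word by split.
    injective : (t : Tree (Fin m)) → Distinct t → {x y : List (Fin m)} →
                Word t x → Word t y → (∀ p → Φ t p x ≡ Φ t p y) → x ≡ y
    injective (leaf a)   _                  wx wy _ = trans (word-leaf a wx) (sym (word-leaf a wy))
    injective (node l r) d@(_ , dl , dr) {x} {y} wx wy same = begin
      x                                                          ≡⟨ sym (split l r d (proj₁ wx)) ⟩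
      interleave (Φ (node l r) here x) (restrict l x) (restrict r x)
                                                                 ≡⟨ cong (λ s → interleave s (restrict l x) (restrict r x)) (same here) ⟩
      interleave (Φ (node l r) here y) (restrict l x) (restrict r x)
                                                                 ≡⟨ cong₂ (interleave (Φ (node l r) here y)) sameˡ sameʳ ⟩
      interleave (Φ (node l r) here y) (restrict l y) (restrict r y)
                                                                 ≡⟨ split l r d (proj₁ wy) ⟩
      y                                                          ∎
      where
      open ≡-Reasoning
      sameˡ : restrict l x ≡ restrict l y
      sameˡ = injective l dl (restrictˡ-word l r wx) (restrictˡ-word l r wy)
                (λ p → trans (Φ-restrict l p x) (trans (same (inl p)) (sym (Φ-restrict l p y))))
      sameʳ : restrict r x ≡ restrict r y
      sameʳ = injective r dr (restrictʳ-word l r wx) (restrictʳ-word l r wy)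
                (λ p → trans (Φ-restrict r p x) (trans (same (inr p)) (sym (Φ-restrict r p y))))

    -- Interleaving a word of l with a word of r along the root pattern of
    -- a word y of node l r reproduces that root pattern: the pattern only
    -- depends on the lengths, and all words of a subtree have equal length.
    root-pattern : (l r : Tree (Fin m)) → Distinct (node l r) → {xl xr y : List (Fin m)} →
                   Word l xl → Word r xr → Word (node l r) y →
                   Φ (node l r) here (interleave (Φ (node l r) here y) xl xr) ≡ Φ (node l r) here y
    root-pattern l r d@(_ , dl , dr) {xl} {xr} {y} wl wr wy = begin
      Φ₀ (interleave s xl xr)                                  ≡⟨ sides (proj₁ wl) (proj₁ wr) ⟩
      interleave s (replicate (length xl) false) (replicate (length xr) true)
        ≡⟨ cong₂ (λ i k → interleave s (replicate i false) (replicate k true))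
                 (word-length l dl wl (restrictˡ-word l r wy)) (word-length r dr wr (restrictʳ-word l r wy)) ⟩
      interleave s (replicate (length (restrict l y)) false) (replicate (length (restrict r y)) true)
        ≡⟨ sym (sides (restrict-Over l y) (restrict-Over r y)) ⟩
      Φ₀ (interleave s (restrict l y) (restrict r y))          ≡⟨ cong Φ₀ (split l r d (proj₁ wy)) ⟩
      Φ₀ y                                                     ∎
      where
      open ≡-Reasoning
      Φ₀ : List (Fin m) → List Bool
      Φ₀ = Φ (node l r) here
      s : List Bool
      s = Φ₀ y
      sides : {a b : List (Fin m)} → Over l a → Over r b →
              Φ₀ (interleave s a b) ≡ interleave s (replicate (length a) false) (replicate (length b) true)
      sides oa ob = mapMaybe-interleave s (All.map (Φ₁-left l r) oa) (All.map (Φ₁-right l r d) ob)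

    module _ (l r : Tree (Fin m)) (d : Distinct (node l r)) (s : List Bool)
             {xl xr : List (Fin m)} (overˡ : Over l xl) (overʳ : Over r xr) where

      restrictˡ-interleave : restrict l (interleave s xl xr) ≡ xl
      restrictˡ-interleave = filterᵇ-interleaveˡ s overˡ (All.map (λ {a} → disjointʳ l r d a) overʳ)

      restrictʳ-interleave : restrict r (interleave s xl xr) ≡ xr
      restrictʳ-interleave = filterᵇ-interleaveʳ s (All.map (λ {a} → proj₁ d a) overˡ) overʳ

      interleave-word : Word l xl → Word r xr → Word (node l r) (interleave s xl xr)
      interleave-word wl wr = node-word l r over
        (subst (Word l) (sym restrictˡ-interleave) wl) (subst (Word r) (sym restrictʳ-interleave) wr)
        where
        over : Over (node l r) (interleave s xl xr)
        over = interleave-All s (All.map (inT-nodeˡ l r) overˡ) (All.map (inT-nodeʳ l r) overʳ)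

    -- Realisable t w : every component w p is the projection Φ t p of some
    -- word of t, i.e. w lies in the product of the images Φ_p(S).
    Realisable : (t : Tree (Fin m)) → (Pos t → List Bool) → Set
    Realisable t w = ∀ p → Σ (List (Fin m)) (λ y → Word t y × Φ t p y ≡ w p)

    realisableˡ : (l r : Tree (Fin m)) {w : Pos (node l r) → List Bool} →
                  Realisable (node l r) w → Realisable l (w ∘ inl)
    realisableˡ l r real p with real (inl p)
    ... | y , wy , e = restrict l y , restrictˡ-word l r wy , trans (Φ-restrict l p y) e

    realisableʳ : (l r : Tree (Fin m)) {w : Pos (node l r) → List Bool} →
                  Realisable (node l r) w → Realisable r (w ∘ inr)
    realisableʳ l r real p with real (inr p)
    ... | y , wy , e = restrict r y , restrictʳ-word l r wy , trans (Φ-restrict r p y) e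

    -- At a node, the
    -- components below l and r are realised inductively by single words
    -- xl and xr; interleaving them along the root component w here (the
    -- root pattern of some word y) realises all of w.
    surjective : (t : Tree (Fin m)) → Distinct t → (w : Pos t → List Bool) → Realisable t w →
                 Σ (List (Fin m)) (λ x → Word t x × (∀ p → Φ t p x ≡ w p))
    surjective (leaf a)   _                  w _ = replicate (ns a) a , replicate-word a , λ ()
    surjective (node l r) d@(_ , dl , dr) w real
      with surjective l dl (w ∘ inl) (realisableˡ l r real)
         | surjective r dr (w ∘ inr) (realisableʳ l r real)
         | real here
    ... | xl , wl , Φxl | xr , wr , Φxr | y , wy , Φy =
      x , interleave-word l r d (w here) (proj₁ wl) (proj₁ wr) wl wr , Φx
      where
      x : List (Fin m)
      x = interleave (w here) xl xr
      Φx : ∀ p → Φ (node l r) p x ≡ w p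
      Φx here    = subst (λ s → Φ (node l r) here (interleave s xl xr) ≡ s) Φy (root-pattern l r d wl wr wy)
      Φx (inl p) = begin
        Φ l p x                ≡⟨ sym (Φ-restrict l p x) ⟩
        Φ l p (restrict l x)   ≡⟨ cong (Φ l p) (restrictˡ-interleave l r d (w here) (proj₁ wl) (proj₁ wr)) ⟩
        Φ l p xl               ≡⟨ Φxl p ⟩
        w (inl p)              ∎
        where open ≡-Reasoning
      Φx (inr p) = begin
        Φ r p x                ≡⟨ sym (Φ-restrict r p x) ⟩
        Φ r p (restrict r x)   ≡⟨ cong (Φ r p) (restrictʳ-interleave l r d (w here) (proj₁ wl) (proj₁ wr)) ⟩
        Φ r p xr               ≡⟨ Φxr p ⟩
        w (inr p)              ∎
        where open ≡-Reasoning

  Unique-++ : (xs : List (Fin m)) {ys : List (Fin m)} → Unique (xs ++ ys) →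
              Unique xs × Unique ys × (∀ {j} → j ∈ xs → ¬ j ∈ ys)
  Unique-++ []       u        = [] , u , λ ()
  Unique-++ (x ∷ xs) (x∉ ∷ u) with Unique-++ xs u
  ... | uxs , uys , disj = AllP.++⁻ˡ xs x∉ ∷ uxs , uys , λ
    { (here refl) j∈ys → All.lookup (AllP.++⁻ʳ xs x∉) j∈ys refl
    ; (there j∈xs)     → disj j∈xs }

  unique⇒distinct : (t : Tree (Fin m)) → Unique (leaves t) → Distinct t
  unique⇒distinct (leaf a)   _ = tt
  unique⇒distinct (node l r) u with Unique-++ (leaves l) u
  ... | ul , ur , disj = disjoint , unique⇒distinct l ul , unique⇒distinct r ur
    where
    disjoint : ∀ a → inT l a ≡ true → inT r a ≡ false
    disjoint a e with inT r a in f
    ... | true  = contradiction (memb⇒∈ (leaves r) f) (disj (memb⇒∈ (leaves l) e))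
    ... | false = refl

module _ {P B : Set} {k : ℕ} (ν : P ↔ Fin k) where
  open Inverse ν using (to; from; strictlyInverseˡ; strictlyInverseʳ)

  tabulate-from-injective : {f g : P → B} → tabulate (f ∘ from) ≡ tabulate (g ∘ from) → ∀ p → f p ≡ g p
  tabulate-from-injective {f} {g} eq p = begin
    f p                                 ≡⟨ cong f (sym (strictlyInverseʳ p)) ⟩
    f (from (to p))                     ≡⟨ sym (lookup∘tabulate (f ∘ from) (to p)) ⟩
    lookup (tabulate (f ∘ from)) (to p) ≡⟨ cong (λ v → lookup v (to p)) eq ⟩
    lookup (tabulate (g ∘ from)) (to p) ≡⟨ lookup∘tabulate (g ∘ from) (to p) ⟩
    g (from (to p))                     ≡⟨ cong g (strictlyInverseʳ p) ⟩
    g p                                 ∎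
    where open ≡-Reasoning

  tabulate-from-lookup : {f : P → B} (v : Vec B k) → (∀ p → f p ≡ lookup v (to p)) → tabulate (f ∘ from) ≡ v
  tabulate-from-lookup v e =
    trans (tabulate-cong (λ i → trans (e (from i)) (cong (lookup v) (strictlyInverseˡ i)))) (tabulate∘lookup v)

-- For a tree whose leaves are a permutation of Fin m, the leaves are
-- distinct and every symbol is a leaf, so S-words are exactly its words.
module CompleteTree {m : ℕ} (t : Tree (Fin m)) (leaves↭ : leaves t ↭ allFin m) where
  open PermutationSetoid (setoid (Fin m)) using (Unique-resp-↭)

  complete-distinct : Distinct t
  complete-distinct = unique⇒distinct t (Unique-resp-↭ (↭⇒↭ₛ (↭-sym leaves↭)) (allFin⁺ m))

  complete-inT : (a : Fin m) → inT t a ≡ true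
  complete-inT a = ∈⇒memb (∈-resp-↭ (↭-sym leaves↭) (∈-allFin a))

  module _ (ns : Fin m → ℕ) where

    InS⇒Word : {z : List (Fin m)} → InS ns z → Word ns t z
    InS⇒Word s = All.tabulate (λ {a} _ → complete-inT a) , λ j _ → s j

    Word⇒InS : {z : List (Fin m)} → Word ns t z → InS ns z
    Word⇒InS (_ , counts) j = counts j (complete-inT j)

lemma4 : (m : ℕ) → 2 ≤ m → (t : Tree (Fin m)) → leaves t ↭ allFin m
    → (ν : Pos t ↔ Fin (m ∸ 1)) → (∀ (l r : Tree (Fin m)) (e : node l r ≡ t) → toℕ (Inverse.to ν (subst Pos e here)) ≡ 0)
    → (ns : Fin m → ℕ)
    → let tuple : List (Fin m) → Vec (List Bool) (m ∸ 1)
          tuple x = tabulate (λ i → Φ t (Inverse.from ν i) x)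
      in ((x y : List (Fin m)) → InS ns x → InS ns y → tuple x ≡ tuple y → x ≡ y)
         × ((x : List (Fin m)) → InS ns x → (i : Fin (m ∸ 1)) → Σ (List (Fin m)) (λ y → InS ns y × Φ t (Inverse.from ν i) y ≡ lookup (tuple x) i))
         × ((v : Vec (List Bool) (m ∸ 1)) → ((i : Fin (m ∸ 1)) → Σ (List (Fin m)) (λ y → InS ns y × Φ t (Inverse.from ν i) y ≡ lookup v i))
            → Σ (List (Fin m)) (λ x → InS ns x × tuple x ≡ v))
lemma4 m _ t leaves↭ ν _ ns = tuple-injective , tuple-in-image , tuple-onto
  where
  open Inverse ν using (to; from; strictlyInverseʳ)
  open CompleteTree t leaves↭
  tuple : List (Fin m) → Vec (List Bool) (m ∸ 1)
  tuple x = tabulate (λ i → Φ t (from i) x)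

  tuple-injective : (x y : List (Fin m)) → InS ns x → InS ns y → tuple x ≡ tuple y → x ≡ y
  tuple-injective x y sx sy eq = injective ns t complete-distinct
    (InS⇒Word ns sx) (InS⇒Word ns sy) (tabulate-from-injective ν eq)

  tuple-in-image : (x : List (Fin m)) → InS ns x → (i : Fin (m ∸ 1)) →
                   Σ (List (Fin m)) (λ y → InS ns y × Φ t (from i) y ≡ lookup (tuple x) i)
  tuple-in-image x sx i = x , sx , sym (lookup∘tabulate (λ i → Φ t (from i) x) i)

  tuple-onto : (v : Vec (List Bool) (m ∸ 1)) →
               ((i : Fin (m ∸ 1)) → Σ (List (Fin m)) (λ y → InS ns y × Φ t (from i) y ≡ lookup v i)) →
               Σ (List (Fin m)) (λ x → InS ns x × tuple x ≡ v)
  tuple-onto v real with surjective ns t complete-distinct (λ p → lookup v (to p)) realisable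
    where
    realisable : Realisable ns t (λ p → lookup v (to p))
    realisable p with real (to p)
    ... | y , sy , e = y , InS⇒Word ns sy , trans (cong (λ q → Φ t q y) (sym (strictlyInverseʳ p))) e
  ... | x , wx , Φx = x , Word⇒InS ns wx , tabulate-from-lookup ν v Φx
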